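{- Let $(x,y,C) \in Q(r)$ with $r \ge 5$. Then $d(j_1,j_2) := 1 - y_{j_1,j_2}$ is a semimetric on $J$, i.e. $d(j,j) = 0$, $d(j_1,j_2) = d(j_2,j_1) \ge 0$, and $d(j_1,j_3) \le d(j_1,j_2) + d(j_2,j_3)$ for all $j,j_1,j_2,j_3 \in J$.
   Context: $J$ is a finite set of unit-length jobs with a partial order $\prec$, and $m, S, c \in \mathbb{N}$. Sherali-Adams lift: for a polytope $K = \{x \in \mathbb{R}^N : Ax \ge b\}$ (whose constraints include $0 \le x_v \le 1$), $SA_r(K)$ is the set of vectors $X$ indexed by subsets of $[N]$ of size at most $r+1$ with $X_\emptyset = 1$ and, for all rows $\ell$ and all $I, H' \subseteq [N]$ with $|I| + |H'| \le r$: $\sum_{H \subseteq H'} (-1)^{|H|} \big(\sum_{v} A_{\ell,v} X_{I \cup H \cup \{v\}} - b_\ell X_{I \cup H}\big) \ge 0$. LP $Q(r)$: let $K$ be the set of vectors $(x_{j,i,s})_{j \in J, i \in [m], s \in \{0,\dots,S-1\}}$ with $\sum_{i \in [m]}\sum_{s} x_{j,i,s} = 1$ for all $j$, $\sum_{j \in J} x_{j,i,s} \le c$ for all $i,s$, and $0 \le x_{j,i,s} \le 1$. A lifted vector $x \in SA_r(K)$ has entries $x_{j,i,s}$ and $x_{(j_1,i_1,s_1),(j_2,i_2,s_2)}$ (entry of the index set $\{(j_1,i_1,s_1),(j_2,i_2,s_2)\}$). $Q(r)$ is the set of $(x,y,C)$ with $x \in SA_r(K)$, $y_{j_1,j_2}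 = \sum_{s=0}^{S-1}\sum_{i \in [m]} x_{(j_1,i,s),(j_2,i,s)}$ for all $j_1,j_2$, $C_{j_2} \ge C_{j_1} + (1-y_{j_1,j_2})$ for all $j_1 \prec j_2$, and $C_j \ge 0$ for all $j$.
   Formalization: The lifted vector x and the vectors y and C have rational entries instead of real ones. -}

module Defs where

open import Data.Nat as ℕ using (ℕ; zero; suc)
open import Data.Nat.Base using (_≤ᵇ_)
open import Data.Bool using (Bool; true; false; if_then_else_; _∧_)
open import Data.Fin as Fin using (Fin; combine; remQuot; _≟_)
open import Data.Fin.Subset using (Subset; inside; outside; ⊥; ⁅_⁆; _∪_; ∣_∣)
open import Data.Integer using (+_)
open import Data.Rational using (ℚ; 0ℚ; 1ℚ; -_; _+_; _*_; _-_; _≤_; _/_)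
open import Data.List as List using (List; []; _∷_; _++_; foldr; map; allFin)
open import Data.Vec using (_∷_; [])
open import Data.Product using (_×_; proj₁; proj₂)
open import Relation.Nullary.Decidable using (⌊_⌋)
open import Relation.Binary.PropositionalEquality using (_≡_)
open import Relation.Binary.Structures using (IsStrictPartialOrder)

sumℚ : List ℚ → ℚ
sumℚ = foldr _+_ 0ℚ

Σ[_]_ : (N : ℕ) → (Fin N → ℚ) → ℚ
Σ[ N ] f = sumℚ (map f (allFin N))

ℕtoℚ : ℕ → ℚ
ℕtoℚ k = (+ k) / 1

ind : Bool → ℚ
ind true  = 1ℚ
ind false = 0ℚ

signed : ℕ → ℚ → ℚ
signed zero          q = q
signed (suc zero)    q = - q
signed (suc (suc k)) q = signed k q

subsetsOf : ∀ {N} → Subset N → List (Subset N)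
subsetsOf [] = [] ∷ []
subsetsOf (outside ∷ h) = map (outside ∷_) (subsetsOf h)
subsetsOf (inside  ∷ h) = map (outside ∷_) (subsetsOf h) ++ map (inside ∷_) (subsetsOf h)

-- a single row  Σ_v coeff v · x_v ≥ rhs
record Row (N : ℕ) : Set where
  constructor row
  field
    coeff : Fin N → ℚ
    rhs   : ℚ
open Row public

-- A lifted vector is given as a function
-- X on subsets of [N]; only the entries on subsets of size ≤ r+1 are ever
-- constrained (the others are irrelevant).
SA : (r N : ℕ) {R : Set} (A : R → Row N) (X : Subset N → ℚ) → Set
SA r N {R} A X =
  (X ⊥ ≡ 1ℚ) ×
  ((ℓ : R) (I H' : Subset N) → ∣ I ∣ ℕ.+ ∣ H' ∣ ℕ.≤ r →
     0ℚ ≤ sumℚ (map (λ H → signed ∣ H ∣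
            ((Σ[ N ] (λ v → coeff (A ℓ) v * X (I ∪ H ∪ ⁅ v ⁆)))
              - rhs (A ℓ) * X (I ∪ H)))
          (subsetsOf H')))

-- The scheduling LP.  Jobs J = Fin n, machines [m] = Fin m, time slots
-- {0,…,S-1} = Fin S.  The variables x_{j,i,s} are indexed by
-- Fin (n * m * S) via the standard bijection `combine`.

Var : (n m S : ℕ) → Set
Var n m S = Fin (n ℕ.* m ℕ.* S)

var : ∀ {n m S} → Fin n → Fin m → Fin S → Var n m S
var j i s = combine (combine j i) s

jobOf : ∀ {n m S} → Var n m S → Fin n
jobOf {n} {m} {S} v = proj₁ (remQuot {n} m (proj₁ (remQuot {n ℕ.* m} S v)))

machOf : ∀ {n m S} → Var n m S → Fin m
machOf {n} {m} {S} v = proj₂ (remQuot {n} m (proj₁ (remQuot {n ℕ.* m} S v)))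

slotOf : ∀ {n m S} → Var n m S → Fin S
slotOf {n} {m} {S} v = proj₂ (remQuot {n ℕ.* m} S v)

data KRow (n m S : ℕ) : Set where
  assign≥ : Fin n → KRow n m S
  assign≤ : Fin n → KRow n m S
  capacity : Fin m → Fin S → KRow n m S
  nonneg : Var n m S → KRow n m S
  atMost1 : Var n m S → KRow n m S

K : (n m S c : ℕ) → KRow n m S → Row (n ℕ.* m ℕ.* S)
K n m S c (assign≥ j) = row (λ v → ind ⌊ jobOf {n} {m} {S} v ≟ j ⌋) 1ℚ
K n m S c (assign≤ j) = row (λ v → - ind ⌊ jobOf {n} {m} {S} v ≟ j ⌋) (- 1ℚ)
K n m S c (capacity i s) =
  row (λ v → - ind (⌊ machOf {n} {m} {S} v ≟ i ⌋ ∧ ⌊ slotOf {n} {m} {S} v ≟ s ⌋)) (- ℕtoℚ c)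
K n m S c (nonneg u) = row (λ v → ind ⌊ v ≟ u ⌋) 0ℚ
K n m S c (atMost1 u) = row (λ v → - ind ⌊ v ≟ u ⌋) (- 1ℚ)

pair : ∀ {N} → (Subset N → ℚ) → Fin N → Fin N → ℚ
pair X a b = X (⁅ a ⁆ ∪ ⁅ b ⁆)

record InQ (r n m S c : ℕ) (_≺_ : Fin n → Fin n → Set)
           (x : Subset (n ℕ.* m ℕ.* S) → ℚ) (y : Fin n → Fin n → ℚ) (C : Fin n → ℚ) : Set where
  field
    lifted : SA r (n ℕ.* m ℕ.* S) (K n m S c) x
    y-def  : ∀ j₁ j₂ → y j₁ j₂ ≡
               Σ[ S ] (λ s → Σ[ m ] (λ i →
                 pair x (var {n} {m} {S} j₁ i s) (var {n} {m} {S} j₂ i s)))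
    prec   : ∀ j₁ j₂ → j₁ ≺ j₂ → C j₁ + (1ℚ - y j₁ j₂) ≤ C j₂
    C≥0    : ∀ j → 0ℚ ≤ C j

IsSemimetric : ∀ {n} → (Fin n → Fin n → ℚ) → Set
IsSemimetric {n} d =
  (∀ j → d j j ≡ 0ℚ) ×
  (∀ j₁ j₂ → d j₁ j₂ ≡ d j₂ j₁) ×
  (∀ j₁ j₂ → 0ℚ ≤ d j₁ j₂) ×
  (∀ j₁ j₂ j₃ → d j₁ j₃ ≤ d j₁ j₂ + d j₂ j₃)

-- Writing x_ab
-- for the lifted entry of {a, b}, the lift of x_a (1 − x_b) ≥ 0 gives
-- x_ab ≤ x_aa, the lift of x_b (1 − x_a)(1 − x_d) ≥ 0 gives
-- x_ab + x_bd ≤ x_b + x_abd, and the lift of x_a x_d (1 − x_b) ≥ 0 gives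
-- x_abd ≤ x_ad; together x_ab + x_bd ≤ x_bb + x_ad.  Summing over the
-- machines and time slots turns these into y_{j₁j₂} ≤ y_{j₁j₁} and
-- y_{j₁j₂} + y_{j₂j₃} ≤ y_{j₂j₂} + y_{j₁j₃}, while the lifted assignment
-- equation Σ_{i,s} x_{j,i,s} = 1 gives y_jj = 1.
module Submission where

open import Defs
open import Data.Nat using (ℕ; _≤_)
open import Data.Fin using (Fin)
open import Data.Fin.Subset using (Subset)
open import Data.Rational using (ℚ; 1ℚ; _-_)
open import Relation.Binary.PropositionalEquality using (_≡_)
open import Relation.Binary.Structures using (IsStrictPartialOrder)

open import Algebra.Bundles using (CommutativeRing; CommutativeMonoid)
import Algebra.Properties.CommutativeSemigroup as CommutativeSemigroupProperties
import Data.Nat as ℕ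
open import Data.Nat using (zero; suc; _<_; z≤n; s≤s)
open import Data.Nat.Properties using (≤-trans; +-identityʳ; +-comm)
open import Data.Fin using (zero; suc; combine; remQuot; punchIn; _↑ˡ_; _↑ʳ_; _≟_)
open import Data.Fin.Properties using (remQuot-combine; punchInᵢ≢i)
open import Data.Fin.Subset using (⊥; ⁅_⁆; _∪_; ∣_∣)
open import Data.Fin.Subset.Properties
  using (∪-identityˡ; ∪-identityʳ; ∪-idem; ∪-comm; ∪-commutativeMonoid; ∣⊥∣≡0; ∣⁅x⁆∣≡1)
open import Data.Rational using (0ℚ; -_; _+_; _*_) renaming (_≤_ to _≤ℚ_)
import Data.Rational.Properties as ℚ
open import Algebra.Properties.Group ℚ.+-0-group using (x∙y⁻¹≈ε⇒x≈y; ⁻¹-involutive)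
open import Data.Rational.Solver using (module +-*-Solver)
open +-*-Solver using (solve; _:+_; _:*_; _:-_; :-_; _:=_; con)
open import Data.List using ([]; _∷_; map; tabulate)
open import Data.Product using (_,_; proj₁; proj₂)
open import Function using (_∘_; id)
open import Relation.Nullary.Decidable using (⌊_⌋)
open import Relation.Binary.PropositionalEquality
  using (refl; sym; trans; cong; cong₂; subst; subst₂; _≢_; ≡-≟-identity; ≢-≟-identity; module ≡-Reasoning)

open import Algebra.Properties.Semiring.Sum (CommutativeRing.semiring ℚ.+-*-commutativeRing)
  using (sum; sum-syntax; sum-cong-≗; sum-replicate-zero; sum-remove; ∑-distrib-+; ∑-comm)

0≤p-q⇒q≤p : ∀ {p q} → 0ℚ ≤ℚ p - q → q ≤ℚ p
0≤p-q⇒q≤p {p} {q} 0≤p-q =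
  subst₂ _≤ℚ_ (ℚ.+-identityˡ q) (solve 2 (λ p q → (p :- q) :+ q := p) refl p q)
         (ℚ.+-monoˡ-≤ q 0≤p-q)

p≤q⇒0≤q-p : ∀ {p q} → p ≤ℚ q → 0ℚ ≤ℚ q - p
p≤q⇒0≤q-p {p} {q} p≤q = subst (_≤ℚ q - p) (ℚ.+-inverseʳ p) (ℚ.+-monoˡ-≤ (- p) p≤q)

p-q≤r-s⇒p+s≤r+q : ∀ {p q r s} → p - q ≤ℚ r - s → p + s ≤ℚ r + q
p-q≤r-s⇒p+s≤r+q {p} {q} {r} {s} h =
  0≤p-q⇒q≤p (subst (0ℚ ≤ℚ_) (solve 4 (λ p q r s → (r :- s) :- (p :- q) := (r :+ q) :- (p :+ s)) refl p q r s)
                   (p≤q⇒0≤q-p h))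

0≤p∧0≤-p⇒p≡0 : ∀ {p} → 0ℚ ≤ℚ p → 0ℚ ≤ℚ - p → p ≡ 0ℚ
0≤p∧0≤-p⇒p≡0 {p} 0≤p 0≤-p =
  ℚ.≤-antisym (subst (_≤ℚ 0ℚ) (⁻¹-involutive p) (ℚ.neg-antimono-≤ 0≤-p)) 0≤p

ind-≡ : ∀ {k} {a b : Fin k} → a ≡ b → ind ⌊ a ≟ b ⌋ ≡ 1ℚ
ind-≡ a≡b = cong (ind ∘ ⌊_⌋) (≡-≟-identity _≟_ a≡b)

ind-≢ : ∀ {k} {a b : Fin k} → a ≢ b → ind ⌊ a ≟ b ⌋ ≡ 0ℚ
ind-≢ a≢b = cong (ind ∘ ⌊_⌋) (≢-≟-identity _≟_ a≢b)

sumℚ-map-tabulate : ∀ {k} {A : Set} (f : A → ℚ) (g : Fin k → A) →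
                    sumℚ (map f (tabulate g)) ≡ sum (f ∘ g)
sumℚ-map-tabulate {zero}  f g = refl
sumℚ-map-tabulate {suc k} f g = cong (f (g zero) +_) (sumℚ-map-tabulate f (g ∘ suc))

Σ≡∑ : ∀ k (f : Fin k → ℚ) → Σ[ k ] f ≡ sum f
Σ≡∑ k f = sumℚ-map-tabulate f id

∑-mono-≤ : ∀ {k} {f g : Fin k → ℚ} → (∀ i → f i ≤ℚ g i) → sum f ≤ℚ sum g
∑-mono-≤ {zero}  f≤g = ℚ.≤-refl
∑-mono-≤ {suc k} f≤g = ℚ.+-mono-≤ (f≤g zero) (∑-mono-≤ (f≤g ∘ suc))

∑-mono-+ : ∀ {k} {f g h l : Fin k → ℚ} → (∀ i → f i + g i ≤ℚ h i + l i) →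
           sum f + sum g ≤ℚ sum h + sum l
∑-mono-+ {f = f} {g} {h} {l} fg≤hl =
  subst₂ _≤ℚ_ (∑-distrib-+ f g) (∑-distrib-+ h l) (∑-mono-≤ fg≤hl)

∑-neg : ∀ {k} (f : Fin k → ℚ) → ∑[ i < k ] (- f i) ≡ - sum f
∑-neg {zero}  f = refl
∑-neg {suc k} f = trans (cong (- f zero +_) (∑-neg (f ∘ suc))) (sym (ℚ.neg-distrib-+ (f zero) (sum (f ∘ suc))))

∑-zero : ∀ {k} {f : Fin k → ℚ} → (∀ i → f i ≡ 0ℚ) → sum f ≡ 0ℚ
∑-zero {k} f≡0 = trans (sum-cong-≗ f≡0) (sum-replicate-zero k)

∑-supported : ∀ {k} (f : Fin k → ℚ) u → (∀ i → i ≢ u → f i ≡ 0ℚ) → sum f ≡ f u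
∑-supported {suc k} f u f≡0 = begin
  sum f                               ≡⟨ sum-remove f ⟩
  f u + ∑[ i < k ] f (punchIn u i) ≡⟨ cong (f u +_) (∑-zero (λ i → f≡0 _ (punchInᵢ≢i u i))) ⟩
  f u + 0ℚ                            ≡⟨ ℚ.+-identityʳ (f u) ⟩
  f u                                 ∎
  where open ≡-Reasoning

∑-↑ˡ-↑ʳ : ∀ a {b} (f : Fin (a ℕ.+ b) → ℚ) →
      sum f ≡ ∑[ i < a ] f (i ↑ˡ b) + ∑[ j < b ] f (a ↑ʳ j)
∑-↑ˡ-↑ʳ zero    f = sym (ℚ.+-identityˡ _)
∑-↑ˡ-↑ʳ (suc a) f = trans (cong (f zero +_) (∑-↑ˡ-↑ʳ a (f ∘ suc))) (sym (ℚ.+-assoc (f zero) _ _))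

∑-combine : ∀ a {b} (f : Fin (a ℕ.* b) → ℚ) →
            sum f ≡ ∑[ i < a ] ∑[ j < b ] f (combine i j)
∑-combine zero    f = refl
∑-combine (suc a) {b} f = trans (∑-↑ˡ-↑ʳ b f) (cong (∑[ j < b ] f (j ↑ˡ _) +_) (∑-combine a _))

-- The linearisation of (A_ℓ x − b_ℓ) · ∏_{v ∈ I ∪ H} x_v under x_v² = x_v;
-- the lifted constraint for (ℓ, I, H') is the linearisation of
-- (A_ℓ x − b_ℓ) · ∏_{v ∈ I} x_v · ∏_{h ∈ H'} (1 − x_h).
linearizedSlack : ∀ {N} {R : Set} → (R → Row N) → (Subset N → ℚ) → R → Subset N → Subset N → ℚ
linearizedSlack {N} A X ℓ I H = (Σ[ N ] λ v → coeff (A ℓ) v * X (I ∪ H ∪ ⁅ v ⁆)) - rhs (A ℓ) * X (I ∪ H)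

subsetsOf-⊥ : ∀ {N} → subsetsOf (⊥ {N}) ≡ ⊥ ∷ []
subsetsOf-⊥ {zero}  = refl
subsetsOf-⊥ {suc N} rewrite subsetsOf-⊥ {N} = refl

subsetsOf-⁅⁆ : ∀ {N} (w : Fin N) → subsetsOf ⁅ w ⁆ ≡ ⊥ ∷ ⁅ w ⁆ ∷ []
subsetsOf-⁅⁆ {suc N} zero    rewrite subsetsOf-⊥ {N} = refl
subsetsOf-⁅⁆ {suc N} (suc w) rewrite subsetsOf-⁅⁆ w  = refl

module _ {N : ℕ} {R : Set} (A : R → Row N) (X : Subset N → ℚ) where

  private
    slack = linearizedSlack A X

  inclusionExclusion : R → Subset N → Subset N → ℚ
  inclusionExclusion ℓ I H' = sumℚ (map (λ H → signed ∣ H ∣ (slack ℓ I H)) (subsetsOf H'))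

  inclusionExclusion-⊥ : ∀ ℓ I → inclusionExclusion ℓ I ⊥ ≡ slack ℓ I ⊥
  inclusionExclusion-⊥ ℓ I rewrite subsetsOf-⊥ {N} | ∣⊥∣≡0 N = ℚ.+-identityʳ _

  inclusionExclusion-⁅⁆ : ∀ ℓ I w → inclusionExclusion ℓ I ⁅ w ⁆ ≡ slack ℓ I ⊥ - slack ℓ I ⁅ w ⁆
  inclusionExclusion-⁅⁆ ℓ I w rewrite subsetsOf-⁅⁆ w | ∣⊥∣≡0 N | ∣⁅x⁆∣≡1 w =
    cong (slack ℓ I ⊥ +_) (ℚ.+-identityʳ _)

  linearizedSlack-single : ∀ {ℓ} u → (∀ v → v ≢ u → coeff (A ℓ) v ≡ 0ℚ) → ∀ I H →
                           slack ℓ I H ≡ coeff (A ℓ) u * X (I ∪ H ∪ ⁅ u ⁆) - rhs (A ℓ) * X (I ∪ H)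
  linearizedSlack-single {ℓ} u vanish I H =
    cong (_- rhs (A ℓ) * X (I ∪ H)) (trans (Σ≡∑ N _) (∑-supported _ u term-vanish))
    where
    term-vanish : ∀ v → v ≢ u → coeff (A ℓ) v * X (I ∪ H ∪ ⁅ v ⁆) ≡ 0ℚ
    term-vanish v v≢u = trans (cong (_* X (I ∪ H ∪ ⁅ v ⁆)) (vanish v v≢u)) (ℚ.*-zeroˡ (X (I ∪ H ∪ ⁅ v ⁆)))

  linearizedSlack-neg : ∀ {ℓ ℓ′} → (∀ v → coeff (A ℓ′) v ≡ - coeff (A ℓ) v) → rhs (A ℓ′) ≡ - rhs (A ℓ) →
                        ∀ I H → slack ℓ′ I H ≡ - slack ℓ I H
  linearizedSlack-neg {ℓ} {ℓ′} coeff-neg rhs-neg I H = begin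
    slack ℓ′ I H
      ≡⟨ cong₂ (λ s b → s - b * X (I ∪ H))
               (trans (Σ≡∑ N _) (sum-cong-≗ (λ v → trans (cong (_* X (I ∪ H ∪ ⁅ v ⁆)) (coeff-neg v))
                                                         (sym (ℚ.neg-distribˡ-* (coeff (A ℓ) v) (X (I ∪ H ∪ ⁅ v ⁆)))))))
               rhs-neg ⟩
    ∑[ v < N ] (- term v) - (- rhs (A ℓ)) * X (I ∪ H)
      ≡⟨ cong (_- (- rhs (A ℓ)) * X (I ∪ H)) (∑-neg term) ⟩
    - sum term - (- rhs (A ℓ)) * X (I ∪ H)
      ≡⟨ solve 3 (λ s b x → (:- s) :- ((:- b) :* x) := :- (s :- b :* x)) refl (sum term) (rhs (A ℓ)) (X (I ∪ H)) ⟩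
    - (sum term - rhs (A ℓ) * X (I ∪ H))
      ≡⟨ cong (λ s → - (s - rhs (A ℓ) * X (I ∪ H))) (sym (Σ≡∑ N term)) ⟩
    - slack ℓ I H ∎
    where
    open ≡-Reasoning
    term : Fin N → ℚ
    term v = coeff (A ℓ) v * X (I ∪ H ∪ ⁅ v ⁆)

  module _ {r : ℕ} (sa : SA r N A X) where

    SA-level₀ : ∀ ℓ I → ∣ I ∣ ≤ r → 0ℚ ≤ℚ slack ℓ I ⊥
    SA-level₀ ℓ I ∣I∣≤r = subst (0ℚ ≤ℚ_) (inclusionExclusion-⊥ ℓ I) (proj₂ sa ℓ I ⊥ size)
      where
      size : ∣ I ∣ ℕ.+ ∣ ⊥ {N} ∣ ≤ r
      size rewrite ∣⊥∣≡0 N | +-identityʳ ∣ I ∣ = ∣I∣≤r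

    SA-level₁ : ∀ ℓ I w → ∣ I ∣ < r → slack ℓ I ⁅ w ⁆ ≤ℚ slack ℓ I ⊥
    SA-level₁ ℓ I w ∣I∣<r = 0≤p-q⇒q≤p (subst (0ℚ ≤ℚ_) (inclusionExclusion-⁅⁆ ℓ I w) (proj₂ sa ℓ I ⁅ w ⁆ size))
      where
      size : ∣ I ∣ ℕ.+ ∣ ⁅ w ⁆ ∣ ≤ r
      size rewrite ∣⁅x⁆∣≡1 w | +-comm ∣ I ∣ 1 = ∣I∣<r

    SA-equality : ∀ {ℓ ℓ′} → (∀ v → coeff (A ℓ′) v ≡ - coeff (A ℓ) v) → rhs (A ℓ′) ≡ - rhs (A ℓ) →
                  ∀ I → ∣ I ∣ ≤ r → slack ℓ I ⊥ ≡ 0ℚ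
    SA-equality {ℓ} {ℓ′} coeff-neg rhs-neg I ∣I∣≤r =
      0≤p∧0≤-p⇒p≡0 (SA-level₀ ℓ I ∣I∣≤r)
        (subst (0ℚ ≤ℚ_) (linearizedSlack-neg coeff-neg rhs-neg I ⊥) (SA-level₀ ℓ′ I ∣I∣≤r))

1-y-isSemimetric : ∀ {k} {y : Fin k → Fin k → ℚ} →
                   (∀ j → y j j ≡ 1ℚ) → (∀ j₁ j₂ → y j₁ j₂ ≡ y j₂ j₁) → (∀ j₁ j₂ → y j₁ j₂ ≤ℚ 1ℚ) →
                   (∀ j₁ j₂ j₃ → y j₁ j₂ + y j₂ j₃ ≤ℚ 1ℚ + y j₁ j₃) →
                   IsSemimetric (λ j₁ j₂ → 1ℚ - y j₁ j₂)
1-y-isSemimetric {y = y} y-diag y-comm y≤1 y-triangle =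
  (λ j → trans (cong (_-_ 1ℚ) (y-diag j)) (ℚ.+-inverseʳ 1ℚ)) ,
  (λ j₁ j₂ → cong (_-_ 1ℚ) (y-comm j₁ j₂)) ,
  (λ j₁ j₂ → p≤q⇒0≤q-p (y≤1 j₁ j₂)) ,
  λ j₁ j₂ j₃ → 0≤p-q⇒q≤p (subst (0ℚ ≤ℚ_) (rearrange (y j₁ j₂) (y j₂ j₃) (y j₁ j₃))
                                  (p≤q⇒0≤q-p (y-triangle j₁ j₂ j₃)))
  where
  rearrange : ∀ a b c → (1ℚ + c) - (a + b) ≡ ((1ℚ - a) + (1ℚ - b)) - (1ℚ - c)
  rearrange = solve 3 (λ a b c → (con 1ℚ :+ c) :- (a :+ b)
                                 := ((con 1ℚ :- a) :+ (con 1ℚ :- b)) :- (con 1ℚ :- c)) refl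

IsSemimetric-cong : ∀ {k} {d d′ : Fin k → Fin k → ℚ} → (∀ j₁ j₂ → d j₁ j₂ ≡ d′ j₁ j₂) →
                    IsSemimetric d → IsSemimetric d′
IsSemimetric-cong {d = d} {d′} d≡d′ (d-diag , d-comm , d-nonneg , d-triangle) =
  (λ j → trans (sym (d≡d′ j j)) (d-diag j)) ,
  (λ j₁ j₂ → trans (sym (d≡d′ j₁ j₂)) (trans (d-comm j₁ j₂) (d≡d′ j₂ j₁))) ,
  (λ j₁ j₂ → subst (0ℚ ≤ℚ_) (d≡d′ j₁ j₂) (d-nonneg j₁ j₂)) ,
  λ j₁ j₂ j₃ → subst₂ _≤ℚ_ (d≡d′ j₁ j₃) (cong₂ _+_ (d≡d′ j₁ j₂) (d≡d′ j₂ j₃)) (d-triangle j₁ j₂ j₃)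

module Schedule (n m S c : ℕ) {r : ℕ} (2≤r : 2 ≤ r) (X : Subset (n ℕ.* m ℕ.* S) → ℚ)
                (sa : SA r (n ℕ.* m ℕ.* S) (K n m S c) X) where

  private
    N = n ℕ.* m ℕ.* S
    slack = linearizedSlack (K n m S c) X
    open CommutativeSemigroupProperties (CommutativeMonoid.commutativeSemigroup (∪-commutativeMonoid N))
      using (x∙yz≈y∙xz)

  V : Fin n → Fin m → Fin S → Fin N
  V = var {n} {m} {S}

  job : Fin N → Fin n
  job = jobOf {n} {m} {S}

  job-V : ∀ j i s → job (V j i s) ≡ j
  job-V j i s = trans (cong (λ p → proj₁ (remQuot {n} m (proj₁ p))) (remQuot-combine (combine j i) s))
                          (cong proj₁ (remQuot-combine j i))

  ∑-job : ∀ j (f : Fin N → ℚ) →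
          ∑[ v < N ] (ind ⌊ job v ≟ j ⌋ * f v) ≡ ∑[ s < S ] ∑[ i < m ] f (V j i s)
  ∑-job j f = begin
    ∑[ v < N ] term v
      ≡⟨ trans (∑-combine (n ℕ.* m) term) (∑-combine n _) ⟩
    ∑[ j′ < n ] ∑[ i < m ] ∑[ s < S ] term (V j′ i s)
      ≡⟨ ∑-supported _ j (λ j′ j′≢j → ∑-zero (λ i → ∑-zero (λ s → off-job j′≢j i s))) ⟩
    ∑[ i < m ] ∑[ s < S ] term (V j i s)
      ≡⟨ sum-cong-≗ (λ i → sum-cong-≗ (λ s → on-job i s)) ⟩
    ∑[ i < m ] ∑[ s < S ] f (V j i s)
      ≡⟨ ∑-comm (λ i s → f (V j i s)) ⟩
    ∑[ s < S ] ∑[ i < m ] f (V j i s) ∎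
    where
    open ≡-Reasoning
    term : Fin N → ℚ
    term v = ind ⌊ job v ≟ j ⌋ * f v
    off-job : ∀ {j′} → j′ ≢ j → ∀ i s → term (V j′ i s) ≡ 0ℚ
    off-job {j′} j′≢j i s =
      trans (cong (_* f (V j′ i s)) (ind-≢ (j′≢j ∘ trans (sym (job-V j′ i s)))))
            (ℚ.*-zeroˡ (f (V j′ i s)))
    on-job : ∀ i s → term (V j i s) ≡ f (V j i s)
    on-job i s = trans (cong (_* f (V j i s)) (ind-≡ (job-V j i s))) (ℚ.*-identityˡ (f (V j i s)))

  slack-nonneg : ∀ u I H → slack (nonneg u) I H ≡ X (I ∪ H ∪ ⁅ u ⁆)
  slack-nonneg u I H = begin
    slack (nonneg u) I H         ≡⟨ linearizedSlack-single (K n m S c) X {nonneg u} u (λ v → ind-≢) I H ⟩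
    ind ⌊ u ≟ u ⌋ * x₁ - 0ℚ * x₀ ≡⟨ cong (λ e → e * x₁ - 0ℚ * x₀) (ind-≡ {a = u} refl) ⟩
    1ℚ * x₁ - 0ℚ * x₀            ≡⟨ solve 2 (λ x₀ x₁ → con 1ℚ :* x₁ :- con 0ℚ :* x₀ := x₁) refl x₀ x₁ ⟩
    x₁                           ∎
    where
    open ≡-Reasoning
    x₀ = X (I ∪ H)
    x₁ = X (I ∪ H ∪ ⁅ u ⁆)

  slack-atMost1 : ∀ u I H → slack (atMost1 u) I H ≡ X (I ∪ H) - X (I ∪ H ∪ ⁅ u ⁆)
  slack-atMost1 u I H = begin
    slack (atMost1 u) I H                ≡⟨ linearizedSlack-single (K n m S c) X {atMost1 u} u
                                                                   (λ v v≢u → cong -_ (ind-≢ v≢u)) I H ⟩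
    (- ind ⌊ u ≟ u ⌋) * x₁ - (- 1ℚ) * x₀ ≡⟨ cong (λ e → (- e) * x₁ - (- 1ℚ) * x₀) (ind-≡ {a = u} refl) ⟩
    (- 1ℚ) * x₁ - (- 1ℚ) * x₀            ≡⟨ solve 2 (λ x₀ x₁ → (:- con 1ℚ) :* x₁ :- (:- con 1ℚ) :* x₀ := x₀ :- x₁)
                                                    refl x₀ x₁ ⟩
    x₀ - x₁                              ∎
    where
    open ≡-Reasoning
    x₀ = X (I ∪ H)
    x₁ = X (I ∪ H ∪ ⁅ u ⁆)

  X-∪-≤ : ∀ {I} w u → ∣ I ∣ < r → X (I ∪ ⁅ w ⁆ ∪ ⁅ u ⁆) ≤ℚ X (I ∪ ⁅ u ⁆)
  X-∪-≤ {I} w u ∣I∣<r =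
    subst₂ _≤ℚ_ (slack-nonneg u I ⁅ w ⁆)
                (trans (slack-nonneg u I ⊥) (cong (λ H → X (I ∪ H)) (∪-identityˡ ⁅ u ⁆)))
                (SA-level₁ (K n m S c) X sa (nonneg u) I w ∣I∣<r)

  X-supermodular : ∀ {I} w u → ∣ I ∣ < r →
                   X (I ∪ ⁅ w ⁆) + X (I ∪ ⁅ u ⁆) ≤ℚ X I + X (I ∪ ⁅ w ⁆ ∪ ⁅ u ⁆)
  X-supermodular {I} w u ∣I∣<r =
    p-q≤r-s⇒p+s≤r+q {X (I ∪ ⁅ w ⁆)} {X (I ∪ ⁅ w ⁆ ∪ ⁅ u ⁆)} {X I} {X (I ∪ ⁅ u ⁆)}
      (subst₂ _≤ℚ_ (slack-atMost1 u I ⁅ w ⁆)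
                   (trans (slack-atMost1 u I ⊥)
                          (cong₂ (λ J H → X J - X (I ∪ H)) (∪-identityʳ I) (∪-identityˡ ⁅ u ⁆)))
                   (SA-level₁ (K n m S c) X sa (atMost1 u) I w ∣I∣<r))

  ∣⊥∣<r : ∣ ⊥ {N} ∣ < r
  ∣⊥∣<r = subst (_< r) (sym (∣⊥∣≡0 N)) (≤-trans (s≤s z≤n) 2≤r)

  ∣⁅⁆∣<r : ∀ (a : Fin N) → ∣ ⁅ a ⁆ ∣ < r
  ∣⁅⁆∣<r a = subst (_< r) (sym (∣⁅x⁆∣≡1 a)) 2≤r

  pair-comm : ∀ a b → pair X a b ≡ pair X b a
  pair-comm a b = cong X (∪-comm ⁅ a ⁆ ⁅ b ⁆)

  pair-diag : ∀ a → pair X a a ≡ X ⁅ a ⁆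
  pair-diag a = cong X (∪-idem ⁅ a ⁆)

  pair-≤-diag : ∀ a b → pair X a b ≤ℚ pair X a a
  pair-≤-diag a b =
    subst₂ _≤ℚ_ (trans (cong X (∪-identityˡ _)) (pair-comm b a))
                (trans (cong X (∪-identityˡ _)) (sym (pair-diag a)))
                (X-∪-≤ b a ∣⊥∣<r)

  pair-triangle : ∀ a b d → pair X a b + pair X b d ≤ℚ pair X b b + pair X a d
  pair-triangle a b d = begin
    pair X a b + pair X b d              ≡⟨ cong (_+ pair X b d) (pair-comm a b) ⟩
    X (B ∪ A) + X (B ∪ D)               ≤⟨ X-supermodular a d (∣⁅⁆∣<r b) ⟩
    X B + X (B ∪ A ∪ D)                 ≡⟨ cong₂ _+_ (sym (pair-diag b)) (cong X (x∙yz≈y∙xz B A D)) ⟩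
    pair X b b + X (A ∪ B ∪ D)          ≤⟨ ℚ.+-monoʳ-≤ (pair X b b) (X-∪-≤ b d (∣⁅⁆∣<r a)) ⟩
    pair X b b + pair X a d             ∎
    where
    open ℚ.≤-Reasoning
    A = ⁅ a ⁆
    B = ⁅ b ⁆
    D = ⁅ d ⁆

  slack-assign≥ : ∀ j → slack (assign≥ j) ⊥ ⊥ ≡ ∑[ s < S ] ∑[ i < m ] X ⁅ V j i s ⁆ - 1ℚ
  slack-assign≥ j = cong₂ (λ t x → t - 1ℚ * x) job-mass X⊥⊥≡1
    where
    job-mass : Σ[ N ] (λ v → ind ⌊ job v ≟ j ⌋ * X (⊥ ∪ ⊥ ∪ ⁅ v ⁆))
               ≡ ∑[ s < S ] ∑[ i < m ] X ⁅ V j i s ⁆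
    job-mass = trans (Σ≡∑ N _) (trans (sum-cong-≗ drop-⊥) (∑-job j (X ∘ ⁅_⁆)))
      where
      drop-⊥ : ∀ v → ind ⌊ job v ≟ j ⌋ * X (⊥ ∪ ⊥ ∪ ⁅ v ⁆) ≡ ind ⌊ job v ≟ j ⌋ * X ⁅ v ⁆
      drop-⊥ v = cong (λ J → ind ⌊ job v ≟ j ⌋ * X J) (trans (∪-identityˡ (⊥ ∪ ⁅ v ⁆)) (∪-identityˡ ⁅ v ⁆))
    X⊥⊥≡1 : X (⊥ ∪ ⊥) ≡ 1ℚ
    X⊥⊥≡1 = trans (cong X (∪-identityˡ ⊥)) (proj₁ sa)

  Y : Fin n → Fin n → ℚ
  Y j₁ j₂ = ∑[ s < S ] ∑[ i < m ] pair X (V j₁ i s) (V j₂ i s)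

  Y-diag : ∀ j → Y j j ≡ 1ℚ
  Y-diag j = x∙y⁻¹≈ε⇒x≈y (Y j j) 1ℚ (begin
    Y j j - 1ℚ
      ≡⟨ cong (_- 1ℚ) (sum-cong-≗ (λ s → sum-cong-≗ (λ i → pair-diag (V j i s)))) ⟩
    ∑[ s < S ] ∑[ i < m ] X ⁅ V j i s ⁆ - 1ℚ
      ≡⟨ slack-assign≥ j ⟨
    slack (assign≥ j) ⊥ ⊥
      ≡⟨ SA-equality (K n m S c) X sa {assign≥ j} {assign≤ j} (λ v → refl) refl ⊥ ∣⊥∣≤r ⟩
    0ℚ ∎)
    where
    open ≡-Reasoning
    ∣⊥∣≤r : ∣ ⊥ {N} ∣ ≤ r
    ∣⊥∣≤r = subst (_≤ r) (sym (∣⊥∣≡0 N)) z≤n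

  Y-comm : ∀ j₁ j₂ → Y j₁ j₂ ≡ Y j₂ j₁
  Y-comm j₁ j₂ = sum-cong-≗ (λ s → sum-cong-≗ (λ i → pair-comm (V j₁ i s) (V j₂ i s)))

  Y-≤-1 : ∀ j₁ j₂ → Y j₁ j₂ ≤ℚ 1ℚ
  Y-≤-1 j₁ j₂ = subst (Y j₁ j₂ ≤ℚ_) (Y-diag j₁)
    (∑-mono-≤ (λ s → ∑-mono-≤ (λ i → pair-≤-diag (V j₁ i s) (V j₂ i s))))

  Y-triangle : ∀ j₁ j₂ j₃ → Y j₁ j₂ + Y j₂ j₃ ≤ℚ 1ℚ + Y j₁ j₃
  Y-triangle j₁ j₂ j₃ = subst (λ t → Y j₁ j₂ + Y j₂ j₃ ≤ℚ t + Y j₁ j₃) (Y-diag j₂)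
    (∑-mono-+ (λ s → ∑-mono-+ (λ i → pair-triangle (V j₁ i s) (V j₂ i s) (V j₃ i s))))

lemma9 : (n m S c r : ℕ) (_≺_ : Fin n → Fin n → Set) → IsStrictPartialOrder _≡_ _≺_ →
         5 ≤ r →
         (x : Subset (n Data.Nat.* m Data.Nat.* S) → ℚ) (y : Fin n → Fin n → ℚ) (C : Fin n → ℚ) →
         InQ r n m S c _≺_ x y C →
         IsSemimetric (λ j₁ j₂ → 1ℚ - y j₁ j₂)
lemma9 n m S c r _ _ 5≤r x y C q =
  IsSemimetric-cong (λ j₁ j₂ → cong (_-_ 1ℚ) (sym (y≡Y j₁ j₂)))
                    (1-y-isSemimetric Y-diag Y-comm Y-≤-1 Y-triangle)
  where
  open InQ q
  open Schedule n m S c (≤-trans (s≤s (s≤s z≤n)) 5≤r) x lifted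
  y≡Y : ∀ j₁ j₂ → y j₁ j₂ ≡ Y j₁ j₂
  y≡Y j₁ j₂ = trans (y-def j₁ j₂)
                    (trans (Σ≡∑ S _) (sum-cong-≗ (λ s → Σ≡∑ m (λ i → pair x (V j₁ i s) (V j₂ i s)))))
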